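{- Let $w\in\mathfrak{S}_n$. If $(a,b)\in E(w)$, then $e_b-e_a$ is an edge vector of $D_w$; that is, $e_b-e_a$ spans a one-dimensional face (extremal ray) of $D_w$.
   Context: Permutations are in one-line notation; $\ell$ is length; $t_{a,b}$ is the transposition of $a,b$; $e_1,\dots,e_n$ is the standard basis of $\mathbb{R}^n$. $E(w)=\{(w(i),w(j)) : 1\le i<j\le n,\ \ell(w)-\ell(t_{w(i),w(j)}w)=1\}$ (equivalently $w(i)>w(j)$ and $w(k)\notin[w(j),w(i)]$ for $i<k<j$), and $D_w$ is the cone in $\mathbb{R}^n$ spanned by $\{e_b-e_a : (a,b)\in E(w)\}$.
   Formalization: The cone $D_w$ and the ray spanned by $e_b-e_a$ are taken in ℚ^n rather than $\mathbb{R}^n$, with nonnegative rational coefficients. -}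

module Defs where

open import Data.Nat using (ℕ)
open import Data.Fin using (Fin; _<_; _≤_; _≟_)
open import Data.Fin.Permutation using (Permutation′; _⟨$⟩ʳ_)
open import Data.Rational as ℚ using (ℚ; 0ℚ; 1ℚ)
open import Data.List using (List; []; _∷_)
open import Data.List.Relation.Unary.All using (All)
open import Data.Product using (Σ; ∃; _×_; _,_)
open import Relation.Nullary using (¬_; yes; no)
open import Relation.Binary.PropositionalEquality using (_≡_)

-- Vectors in ℚ^n (coordinates indexed by Fin n; e_1..e_n ↦ e zero .. e (n-1)).
Vecℚ : ℕ → Set
Vecℚ n = Fin n → ℚ

e : ∀ {n} → Fin n → Vecℚ n
e a k with k ≟ a
... | yes _ = 1ℚ
... | no  _ = 0ℚ

_⊕_ : ∀ {n} → Vecℚ n → Vecℚ n → Vecℚ n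
(x ⊕ y) k = x k ℚ.+ y k

_⊖_ : ∀ {n} → Vecℚ n → Vecℚ n → Vecℚ n
(x ⊖ y) k = x k ℚ.- y k

_·_ : ∀ {n} → ℚ → Vecℚ n → Vecℚ n
(t · x) k = t ℚ.* x k

𝟎 : ∀ {n} → Vecℚ n
𝟎 k = 0ℚ

_≈v_ : ∀ {n} → Vecℚ n → Vecℚ n → Set
x ≈v y = ∀ k → x k ≡ y k

InE : ∀ {n} → Permutation′ n → Fin n → Fin n → Set
InE {n} w a b =
  Σ (Fin n) λ i → Σ (Fin n) λ j →
    i < j × (w ⟨$⟩ʳ i) ≡ a × (w ⟨$⟩ʳ j) ≡ b × b < a ×
    (∀ (k : Fin n) → i < k → k < j →
       ¬ ((b ≤ (w ⟨$⟩ʳ k)) × ((w ⟨$⟩ʳ k) ≤ a)))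

gen : ∀ {n} → Fin n → Fin n → Vecℚ n
gen a b = e b ⊖ e a

comb : ∀ {n} → List (ℚ × Fin n × Fin n) → Vecℚ n
comb [] = 𝟎
comb ((t , a , b) ∷ ts) = (t · gen a b) ⊕ comb ts

InD : ∀ {n} → Permutation′ n → Vecℚ n → Set
InD {n} w x = ∃ λ (ts : List (ℚ × Fin n × Fin n)) →
  All (λ { (t , a , b) → (0ℚ ℚ.≤ t) × InE w a b }) ts × (x ≈v comb ts)

InRay : ∀ {n} → Vecℚ n → Vecℚ n → Set
InRay v x = ∃ λ t → (0ℚ ℚ.≤ t) × (x ≈v (t · v))

IsExtremalRay : ∀ {n} → (Vecℚ n → Set) → Vecℚ n → Set
IsExtremalRay C v =
  C v × ¬ (v ≈v 𝟎) ×
  (∀ x y → C x → C y → InRay v (x ⊕ y) → InRay v x × InRay v y)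

{-# OPTIONS --safe #-}
-- A supporting hyperplane cuts the ray out of D_w. Let a = w(p), b = w(q), and let
-- G (on positions) and H (on values) be weakly increasing maps ℕ → ℕ that are strictly
-- increasing except that G collapses [p, q] and H collapses [b, a]. For
-- Φ(v) = G(w⁻¹ v) − H(v) and an inversion c = w(i) > d = w(j), i < j, we get
-- Φ(d) − Φ(c) = (G j − G i) + (H c − H d) ≥ 0, with equality only if p ≤ i < j ≤ q and
-- b ≤ d < c ≤ a; the gap condition of (a,b) ∈ E(w) then forces (i, j) = (p, q). So the
-- linear form ⟨Φ, ·⟩ is ≥ 0 on D_w and vanishes on it exactly along the ray of e_b − e_a.
module Submission where

open import Defs
open import Data.Nat.Base as ℕ using (ℕ; zero; suc; _⊓_; _∸_)
import Data.Nat.Properties as ℕₚ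
open import Data.Fin.Base as Fin using (Fin; toℕ; punchIn)
open import Data.Fin.Properties as Finₚ using (_≟_)
open import Data.Fin.Permutation using (Permutation′; _⟨$⟩ʳ_; _⟨$⟩ˡ_; inverseˡ)
open import Data.Integer.Base as ℤ using (+≤+; +<+)
import Data.Integer.Properties as ℤₚ
open import Data.Rational.Base
  using (ℚ; 0ℚ; 1ℚ; _+_; _-_; _*_; -_; _≤_; _<_; *≤*; *<*; nonNegative; positive)
open import Data.Rational.Literals using (fromℤ)
import Data.Rational.Properties as ℚₚ
open import Data.Rational.Solver using (module +-*-Solver)
open import Algebra.Bundles using (Ring)
open import Algebra.Properties.Semiring.Sum (Ring.semiring ℚₚ.+-*-ring)
  using (sum; sum-cong-≗; ∑-distrib-+; *-distribˡ-sum; sum-remove; sum-replicate-zero)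
open import Algebra.Properties.Ring ℚₚ.+-*-ring using (-1*x≈-x)
open import Data.List.Base using ([]; _∷_)
open import Data.List.Relation.Unary.All as All using (All; []; _∷_)
open import Data.Product.Base using (_×_; _,_; ∃-syntax)
open import Data.Sum.Base as Sum using (_⊎_; inj₁; inj₂)
open import Function.Base using (_∘_)
open import Relation.Nullary using (¬_; yes; no; contradiction)
open import Relation.Binary.PropositionalEquality

ι : ℕ → ℚ
ι m = fromℤ (ℤ.+ m)

ι-mono-≤ : ∀ {m n} → m ℕ.≤ n → ι m ≤ ι n
ι-mono-≤ {m} {n} m≤n =
  *≤* (subst₂ ℤ._≤_ (sym (ℤₚ.*-identityʳ (ℤ.+ m))) (sym (ℤₚ.*-identityʳ (ℤ.+ n))) (+≤+ m≤n))

ι-mono-< : ∀ {m n} → m ℕ.< n → ι m < ι n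
ι-mono-< {m} {n} m<n =
  *<* (subst₂ ℤ._<_ (sym (ℤₚ.*-identityʳ (ℤ.+ m))) (sym (ℤₚ.*-identityʳ (ℤ.+ n))) (+<+ m<n))

ι-∸-mono-< : ∀ {m m′ n n′} → m ℕ.≤ m′ → n′ ℕ.≤ n → m ℕ.< m′ ⊎ n′ ℕ.< n →
             ι m - ι n < ι m′ - ι n′
ι-∸-mono-< _    n′≤n (inj₁ m<m′) = ℚₚ.+-mono-<-≤ (ι-mono-< m<m′) (ℚₚ.neg-antimono-≤ (ι-mono-≤ n′≤n))
ι-∸-mono-< m≤m′ _    (inj₂ n′<n) = ℚₚ.+-mono-≤-< (ι-mono-≤ m≤m′) (ℚₚ.neg-antimono-< (ι-mono-< n′<n))

+-nonNeg : ∀ {p q} → 0ℚ ≤ p → 0ℚ ≤ q → 0ℚ ≤ p + q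
+-nonNeg = ℚₚ.+-mono-≤

*-nonNeg : ∀ {p q} → 0ℚ ≤ p → 0ℚ ≤ q → 0ℚ ≤ p * q
*-nonNeg {p} {q} 0≤p 0≤q = ℚₚ.nonNegative⁻¹ _
  {{ℚₚ.nonNeg*nonNeg⇒nonNeg p {{nonNegative 0≤p}} q {{nonNegative 0≤q}}}}

nonNeg+nonNeg≡0⇒≡0 : ∀ {p q} → 0ℚ ≤ p → 0ℚ ≤ q → p + q ≡ 0ℚ → p ≡ 0ℚ × q ≡ 0ℚ
nonNeg+nonNeg≡0⇒≡0 {p} {q} 0≤p 0≤q p+q≡0 = ≤0⇒≡0 0≤p p≤0 , ≤0⇒≡0 0≤q q≤0
  where
  ≤0⇒≡0 : ∀ {r} → 0ℚ ≤ r → r ≤ 0ℚ → r ≡ 0ℚ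
  ≤0⇒≡0 0≤r r≤0 = ℚₚ.≤-antisym r≤0 0≤r
  p≤0 : p ≤ 0ℚ
  p≤0 = subst₂ _≤_ (ℚₚ.+-identityʳ p) p+q≡0 (ℚₚ.+-monoʳ-≤ p 0≤q)
  q≤0 : q ≤ 0ℚ
  q≤0 = subst₂ _≤_ (ℚₚ.+-identityˡ q) p+q≡0 (ℚₚ.+-monoˡ-≤ q 0≤p)

nonNeg*pos≡0⇒≡0 : ∀ {p q} → 0ℚ ≤ p → 0ℚ < q → p * q ≡ 0ℚ → p ≡ 0ℚ
nonNeg*pos≡0⇒≡0 {p} {q} 0≤p 0<q p*q≡0 = ℚₚ.≤-antisym p≤0 0≤p
  where
  p≤0 : p ≤ 0ℚ
  p≤0 = ℚₚ.*-cancelʳ-≤-pos q {{positive 0<q}}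
          (subst₂ _≤_ (sym p*q≡0) (sym (ℚₚ.*-zeroˡ q)) ℚₚ.≤-refl)

p<q⇒0<q-p : ∀ {p q} → p < q → 0ℚ < q - p
p<q⇒0<q-p {p} {q} p<q = subst (_< q - p) (ℚₚ.+-inverseʳ p) (ℚₚ.+-monoˡ-< (- p) p<q)

pairing : ∀ {n} → (Fin n → ℚ) → Vecℚ n → ℚ
pairing Φ x = sum (λ k → x k * Φ k)

e-diag : ∀ {n} (a : Fin n) → e a a ≡ 1ℚ
e-diag a with a ≟ a
... | yes _   = refl
... | no a≢a = contradiction refl a≢a

e-off : ∀ {n} {a k : Fin n} → k ≢ a → e a k ≡ 0ℚ
e-off {a = a} {k} k≢a with k ≟ a
... | yes k≡a = contradiction k≡a k≢a
... | no _    = refl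

pairing-e : ∀ {n} (Φ : Fin n → ℚ) a → pairing Φ (e a) ≡ Φ a
pairing-e {zero}  Φ ()
pairing-e {suc n} Φ a = begin
  sum eΦ                              ≡⟨ sum-remove {i = a} eΦ ⟩
  e a a * Φ a + sum (eΦ ∘ punchIn a)  ≡⟨ cong₂ _+_ diagonal off-diagonal ⟩
  Φ a + 0ℚ                            ≡⟨ ℚₚ.+-identityʳ (Φ a) ⟩
  Φ a                                 ∎
  where
  open ≡-Reasoning
  eΦ : Fin (suc n) → ℚ
  eΦ k = e a k * Φ k
  diagonal : e a a * Φ a ≡ Φ a
  diagonal = trans (cong (_* Φ a) (e-diag a)) (ℚₚ.*-identityˡ (Φ a))
  off-diagonal : sum (eΦ ∘ punchIn a) ≡ 0ℚ
  off-diagonal = trans (sum-cong-≗ vanishes) (sum-replicate-zero n)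
    where
    vanishes : ∀ k → eΦ (punchIn a k) ≡ 0ℚ
    vanishes k = trans (cong (_* Φ (punchIn a k)) (e-off (Finₚ.punchInᵢ≢i a k)))
                       (ℚₚ.*-zeroˡ (Φ (punchIn a k)))

module _ {n} (Φ : Fin n → ℚ) where

  pairing-𝟎 : pairing Φ 𝟎 ≡ 0ℚ
  pairing-𝟎 = trans (sum-cong-≗ (λ k → ℚₚ.*-zeroˡ (Φ k))) (sum-replicate-zero n)

  pairing-cong : ∀ {x y} → x ≈v y → pairing Φ x ≡ pairing Φ y
  pairing-cong x≈y = sum-cong-≗ (λ k → cong (_* Φ k) (x≈y k))

  pairing-⊕ : ∀ x y → pairing Φ (x ⊕ y) ≡ pairing Φ x + pairing Φ y
  pairing-⊕ x y = trans (sum-cong-≗ (λ k → ℚₚ.*-distribʳ-+ (Φ k) (x k) (y k)))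
                        (∑-distrib-+ (λ k → x k * Φ k) (λ k → y k * Φ k))

  pairing-· : ∀ t x → pairing Φ (t · x) ≡ t * pairing Φ x
  pairing-· t x = trans (sum-cong-≗ (λ k → ℚₚ.*-assoc t (x k) (Φ k)))
                        (sym (*-distribˡ-sum t (λ k → x k * Φ k)))

  pairing-⊖ : ∀ x y → pairing Φ (x ⊖ y) ≡ pairing Φ x - pairing Φ y
  pairing-⊖ x y = begin
    sum (λ k → (x k - y k) * Φ k)          ≡⟨ sum-cong-≗ (λ k → distrib (x k) (y k) (Φ k)) ⟩
    sum (λ k → xΦ k + (- 1ℚ) * yΦ k)      ≡⟨ ∑-distrib-+ xΦ (λ k → (- 1ℚ) * yΦ k) ⟩
    sum xΦ + sum (λ k → (- 1ℚ) * yΦ k)    ≡⟨ cong (sum xΦ +_) (*-distribˡ-sum (- 1ℚ) yΦ) ⟨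
    sum xΦ + (- 1ℚ) * sum yΦ              ≡⟨ cong (sum xΦ +_) (-1*x≈-x (sum yΦ)) ⟩
    sum xΦ - sum yΦ                       ∎
    where
    open ≡-Reasoning
    open +-*-Solver
    xΦ yΦ : Fin n → ℚ
    xΦ k = x k * Φ k
    yΦ k = y k * Φ k
    distrib : ∀ u v φ → (u - v) * φ ≡ u * φ + (- 1ℚ) * (v * φ)
    distrib = solve 3 (λ u v φ → (u :- v) :* φ := u :* φ :+ (:- con 1ℚ) :* (v :* φ)) refl

  pairing-gen : ∀ c d → pairing Φ (gen c d) ≡ Φ d - Φ c
  pairing-gen c d = trans (pairing-⊖ (e d) (e c)) (cong₂ _-_ (pairing-e Φ d) (pairing-e Φ c))

  pairing-comb-∷ : ∀ t c d ts →
                   pairing Φ (comb ((t , c , d) ∷ ts)) ≡ t * (Φ d - Φ c) + pairing Φ (comb ts)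
  pairing-comb-∷ t c d ts = begin
    pairing Φ ((t · gen c d) ⊕ comb ts)             ≡⟨ pairing-⊕ (t · gen c d) (comb ts) ⟩
    pairing Φ (t · gen c d) + pairing Φ (comb ts)    ≡⟨ cong (_+ _) (pairing-· t (gen c d)) ⟩
    t * pairing Φ (gen c d) + pairing Φ (comb ts)    ≡⟨ cong (λ s → t * s + _) (pairing-gen c d) ⟩
    t * (Φ d - Φ c) + pairing Φ (comb ts)            ∎
    where open ≡-Reasoning

module _ {n} {v : Vecℚ n} where

  InRay-resp-≈v : ∀ {x y} → x ≈v y → InRay v y → InRay v x
  InRay-resp-≈v x≈y (t , 0≤t , y≈tv) = t , 0≤t , λ k → trans (x≈y k) (y≈tv k)

  InRay-𝟎 : InRay v 𝟎
  InRay-𝟎 = 0ℚ , ℚₚ.≤-refl , λ k → sym (ℚₚ.*-zeroˡ (v k))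

  InRay-· : ∀ {t} → 0ℚ ≤ t → InRay v (t · v)
  InRay-· {t} 0≤t = t , 0≤t , λ _ → refl

  InRay-⊕ : ∀ {x y} → InRay v x → InRay v y → InRay v (x ⊕ y)
  InRay-⊕ (s , 0≤s , x≈sv) (t , 0≤t , y≈tv) =
    s + t , +-nonNeg 0≤s 0≤t ,
    λ k → trans (cong₂ _+_ (x≈sv k) (y≈tv k)) (sym (ℚₚ.*-distribʳ-+ (v k) s t))

module SupportingFunctional {n} (Φ : Fin n → ℚ) {a b : Fin n} (Φa≡Φb : Φ a ≡ Φ b) where

  Admissible : ℚ × Fin n × Fin n → Set
  Admissible (t , c , d) = 0ℚ ≤ t × (Φ c < Φ d ⊎ (c ≡ a × d ≡ b))

  Φb-Φa≡0 : Φ b - Φ a ≡ 0ℚ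
  Φb-Φa≡0 = trans (cong (_- Φ a) (sym Φa≡Φb)) (ℚₚ.+-inverseʳ (Φ a))

  term-nonNeg : ∀ {t c d} → Admissible (t , c , d) → 0ℚ ≤ t * (Φ d - Φ c)
  term-nonNeg (0≤t , inj₁ Φc<Φd)        = *-nonNeg 0≤t (ℚₚ.<⇒≤ (p<q⇒0<q-p Φc<Φd))
  term-nonNeg (0≤t , inj₂ (refl , refl)) = *-nonNeg 0≤t (ℚₚ.≤-reflexive (sym Φb-Φa≡0))

  term≡0⇒InRay : ∀ {t c d} → Admissible (t , c , d) → t * (Φ d - Φ c) ≡ 0ℚ →
                 InRay (gen a b) (t · gen c d)
  term≡0⇒InRay {c = c} {d} (0≤t , inj₁ Φc<Φd) t*δ≡0
    with refl ← nonNeg*pos≡0⇒≡0 0≤t (p<q⇒0<q-p Φc<Φd) t*δ≡0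
    = InRay-resp-≈v (λ k → ℚₚ.*-zeroˡ (gen c d k)) InRay-𝟎
  term≡0⇒InRay (0≤t , inj₂ (refl , refl)) _ = InRay-· 0≤t

  pairing-comb-nonNeg : ∀ {ts} → All Admissible ts → 0ℚ ≤ pairing Φ (comb ts)
  pairing-comb-nonNeg [] = ℚₚ.≤-reflexive (sym (pairing-𝟎 Φ))
  pairing-comb-nonNeg {(t , c , d) ∷ ts} (adm ∷ adms) =
    subst (0ℚ ≤_) (sym (pairing-comb-∷ Φ t c d ts))
          (+-nonNeg (term-nonNeg adm) (pairing-comb-nonNeg adms))

  pairing-comb≡0⇒InRay : ∀ {ts} → All Admissible ts → pairing Φ (comb ts) ≡ 0ℚ →
                         InRay (gen a b) (comb ts)
  pairing-comb≡0⇒InRay [] _ = InRay-𝟎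
  pairing-comb≡0⇒InRay {(t , c , d) ∷ ts} (adm ∷ adms) pairing≡0 =
    let (term≡0 , rest≡0) = nonNeg+nonNeg≡0⇒≡0 (term-nonNeg adm) (pairing-comb-nonNeg adms)
                              (trans (sym (pairing-comb-∷ Φ t c d ts)) pairing≡0)
    in InRay-⊕ (term≡0⇒InRay adm term≡0) (pairing-comb≡0⇒InRay adms rest≡0)

supporting-functional⇒extremal :
  ∀ {n} (w : Permutation′ n) {a b : Fin n} (Φ : Fin n → ℚ) → Φ a ≡ Φ b →
  (∀ {c d} → InE w c d → Φ c < Φ d ⊎ (c ≡ a × d ≡ b)) →
  InE w a b → IsExtremalRay (InD w) (gen a b)
supporting-functional⇒extremal {n} w {a} {b} Φ Φa≡Φb supports ab∈E@(_ , _ , _ , _ , _ , b<a , _) =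
  gen∈D , gen≉𝟎 , extremal
  where
  open SupportingFunctional Φ Φa≡Φb
  v : Vecℚ n
  v = gen a b

  gen∈D : InD w v
  gen∈D = (1ℚ , a , b) ∷ [] , (ℚₚ.nonNegative⁻¹ 1ℚ , ab∈E) ∷ [] ,
          λ k → sym (trans (ℚₚ.+-identityʳ _) (ℚₚ.*-identityˡ (v k)))

  gen≉𝟎 : ¬ (v ≈v 𝟎)
  gen≉𝟎 v≈𝟎 = ℚₚ.1≢0 (trans (sym (cong₂ _-_ (e-diag b) (e-off (Finₚ.<⇒≢ b<a)))) (v≈𝟎 b))

  admissible-comb : ∀ {x} → InD w x → ∃[ ts ] All Admissible ts × x ≈v comb ts
  admissible-comb (ts , entries , x≈) =
    ts , All.map (λ { {t , c , d} (0≤t , cd∈E) → 0≤t , supports cd∈E }) entries , x≈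

  pairing-nonNeg : ∀ {x} → InD w x → 0ℚ ≤ pairing Φ x
  pairing-nonNeg x∈D =
    let (_ , adms , x≈) = admissible-comb x∈D
    in subst (0ℚ ≤_) (sym (pairing-cong Φ x≈)) (pairing-comb-nonNeg adms)

  pairing≡0⇒InRay : ∀ {x} → InD w x → pairing Φ x ≡ 0ℚ → InRay v x
  pairing≡0⇒InRay x∈D pairing≡0 =
    let (_ , adms , x≈) = admissible-comb x∈D
    in InRay-resp-≈v x≈ (pairing-comb≡0⇒InRay adms (trans (sym (pairing-cong Φ x≈)) pairing≡0))

  extremal : ∀ x y → InD w x → InD w y → InRay v (x ⊕ y) → InRay v x × InRay v y
  extremal x y x∈D y∈D (s , _ , x⊕y≈sv) =
    let (x≡0 , y≡0) = nonNeg+nonNeg≡0⇒≡0 (pairing-nonNeg x∈D) (pairing-nonNeg y∈D) sum≡0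
    in pairing≡0⇒InRay x∈D x≡0 , pairing≡0⇒InRay y∈D y≡0
    where
    open ≡-Reasoning
    sum≡0 : pairing Φ x + pairing Φ y ≡ 0ℚ
    sum≡0 = begin
      pairing Φ x + pairing Φ y  ≡⟨ pairing-⊕ Φ x y ⟨
      pairing Φ (x ⊕ y)          ≡⟨ pairing-cong Φ x⊕y≈sv ⟩
      pairing Φ (s · v)          ≡⟨ pairing-· Φ s v ⟩
      s * pairing Φ v            ≡⟨ cong (s *_) (trans (pairing-gen Φ a b) Φb-Φa≡0) ⟩
      s * 0ℚ                     ≡⟨ ℚₚ.*-zeroʳ s ⟩
      0ℚ                         ∎

collapse : ℕ → ℕ → ℕ → ℕ
collapse lo hi x = x ⊓ lo ℕ.+ (x ∸ hi)

collapse-mono-≤ : ∀ lo hi {x y} → x ℕ.≤ y → collapse lo hi x ℕ.≤ collapse lo hi y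
collapse-mono-≤ lo hi x≤y = ℕₚ.+-mono-≤ (ℕₚ.⊓-monoˡ-≤ lo x≤y) (ℕₚ.∸-monoˡ-≤ hi x≤y)

collapse-constant : ∀ {lo hi x} → lo ℕ.≤ x → x ℕ.≤ hi → collapse lo hi x ≡ lo
collapse-constant {lo} lo≤x x≤hi =
  trans (cong₂ ℕ._+_ (ℕₚ.m≥n⇒m⊓n≡n lo≤x) (ℕₚ.m≤n⇒m∸n≡0 x≤hi)) (ℕₚ.+-identityʳ lo)

m<o∧n<o⇒m∸n<o∸n : ∀ {m n o} → m ℕ.< o → n ℕ.< o → m ∸ n ℕ.< o ∸ n
m<o∧n<o⇒m∸n<o∸n {n = n} {suc o} (ℕ.s≤s m≤o) (ℕ.s≤s n≤o) =
  ℕₚ.≤-<-trans (ℕₚ.∸-monoˡ-≤ n m≤o) (ℕₚ.∸-monoˡ-< (ℕₚ.n<1+n o) n≤o)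

collapse-mono-< : ∀ lo hi {x y} → x ℕ.< y → x ℕ.< lo ⊎ hi ℕ.< y →
                  collapse lo hi x ℕ.< collapse lo hi y
collapse-mono-< lo hi {x} {y} x<y (inj₁ x<lo) =
  ℕₚ.+-mono-<-≤ (subst (ℕ._< y ⊓ lo) (sym (ℕₚ.m≤n⇒m⊓n≡m (ℕₚ.<⇒≤ x<lo))) (ℕₚ.⊓-pres-m< x<y x<lo))
                (ℕₚ.∸-monoˡ-≤ hi (ℕₚ.<⇒≤ x<y))
collapse-mono-< lo hi x<y (inj₂ hi<y) =
  ℕₚ.+-mono-≤-< (ℕₚ.⊓-monoˡ-≤ lo (ℕₚ.<⇒≤ x<y)) (m<o∧n<o⇒m∸n<o∸n x<y hi<y)

collapse-≡⇒within : ∀ lo hi {x y} → x ℕ.< y → collapse lo hi x ≡ collapse lo hi y →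
                    lo ℕ.≤ x × y ℕ.≤ hi
collapse-≡⇒within lo hi {x} {y} x<y eq = ℕₚ.≮⇒≥ (outside ∘ inj₁) , ℕₚ.≮⇒≥ (outside ∘ inj₂)
  where
  outside : ¬ (x ℕ.< lo ⊎ hi ℕ.< y)
  outside = ℕₚ.<-irrefl eq ∘ collapse-mono-< lo hi x<y

≤∧≤⇒<⊎≡ : ∀ {m m′ n n′} → m ℕ.≤ m′ → n ℕ.≤ n′ → (m ℕ.< m′ ⊎ n ℕ.< n′) ⊎ (m ≡ m′ × n ≡ n′)
≤∧≤⇒<⊎≡ m≤m′ n≤n′ with ℕₚ.m≤n⇒m<n∨m≡n m≤m′ | ℕₚ.m≤n⇒m<n∨m≡n n≤n′
... | inj₁ m<m′ | _         = inj₁ (inj₁ m<m′)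
... | inj₂ _    | inj₁ n<n′ = inj₁ (inj₂ n<n′)
... | inj₂ m≡m′ | inj₂ n≡n′ = inj₂ (m≡m′ , n≡n′)

collapsedWeight : ∀ {n} → Permutation′ n → (p q b a : Fin n) → Fin n → ℚ
collapsedWeight w p q b a v =
  ι (collapse (toℕ p) (toℕ q) (toℕ (w ⟨$⟩ˡ v))) - ι (collapse (toℕ b) (toℕ a) (toℕ v))

module CollapsedWeight {n} (w : Permutation′ n) (p q b a : Fin n) where

  G H : Fin n → ℕ
  G i = collapse (toℕ p) (toℕ q) (toℕ i)
  H v = collapse (toℕ b) (toℕ a) (toℕ v)

  Φ : Fin n → ℚ
  Φ = collapsedWeight w p q b a

  Φ-∘w : ∀ i → Φ (w ⟨$⟩ʳ i) ≡ ι (G i) - ι (H (w ⟨$⟩ʳ i))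
  Φ-∘w i = cong (λ j → ι (G j) - ι (H (w ⟨$⟩ʳ i))) (inverseˡ w)

  Φ-window : ∀ {i} → p Fin.≤ i → i Fin.≤ q → b Fin.≤ w ⟨$⟩ʳ i → w ⟨$⟩ʳ i Fin.≤ a →
             Φ (w ⟨$⟩ʳ i) ≡ ι (toℕ p) - ι (toℕ b)
  Φ-window {i} p≤i i≤q b≤wi wi≤a =
    trans (Φ-∘w i)
          (cong₂ (λ g h → ι g - ι h) (collapse-constant p≤i i≤q) (collapse-constant b≤wi wi≤a))

  Φ-inversion : ∀ {i j} → i Fin.< j → w ⟨$⟩ʳ j Fin.< w ⟨$⟩ʳ i →
                Φ (w ⟨$⟩ʳ i) < Φ (w ⟨$⟩ʳ j) ⊎
                (p Fin.≤ i × j Fin.≤ q × b Fin.≤ w ⟨$⟩ʳ j × w ⟨$⟩ʳ i Fin.≤ a)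
  Φ-inversion {i} {j} i<j wj<wi = Sum.map strict window (≤∧≤⇒<⊎≡ G≤ H≤)
    where
    G≤ : G i ℕ.≤ G j
    G≤ = collapse-mono-≤ (toℕ p) (toℕ q) (ℕₚ.<⇒≤ i<j)
    H≤ : H (w ⟨$⟩ʳ j) ℕ.≤ H (w ⟨$⟩ʳ i)
    H≤ = collapse-mono-≤ (toℕ b) (toℕ a) (ℕₚ.<⇒≤ wj<wi)
    strict : G i ℕ.< G j ⊎ H (w ⟨$⟩ʳ j) ℕ.< H (w ⟨$⟩ʳ i) → Φ (w ⟨$⟩ʳ i) < Φ (w ⟨$⟩ʳ j)
    strict = subst₂ _<_ (sym (Φ-∘w i)) (sym (Φ-∘w j)) ∘ ι-∸-mono-< G≤ H≤
    window : G i ≡ G j × H (w ⟨$⟩ʳ j) ≡ H (w ⟨$⟩ʳ i) →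
             p Fin.≤ i × j Fin.≤ q × b Fin.≤ w ⟨$⟩ʳ j × w ⟨$⟩ʳ i Fin.≤ a
    window (G≡ , H≡) =
      let (p≤i , j≤q) = collapse-≡⇒within (toℕ p) (toℕ q) i<j G≡
          (b≤wj , wi≤a) = collapse-≡⇒within (toℕ b) (toℕ a) wj<wi H≡
      in p≤i , j≤q , b≤wj , wi≤a

inversion-in-window⇒endpoints :
  ∀ {n} (w : Permutation′ n) {p q a b i j : Fin n} →
  (∀ k → p Fin.< k → k Fin.< q → ¬ (b Fin.≤ w ⟨$⟩ʳ k × w ⟨$⟩ʳ k Fin.≤ a)) →
  i Fin.< j → w ⟨$⟩ʳ j Fin.< w ⟨$⟩ʳ i →
  p Fin.≤ i → j Fin.≤ q → b Fin.≤ w ⟨$⟩ʳ j → w ⟨$⟩ʳ i Fin.≤ a → i ≡ p × j ≡ q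
inversion-in-window⇒endpoints w {p} {q} {i = i} {j} gap i<j wj<wi p≤i j≤q b≤wj wi≤a =
  Finₚ.≤-antisym (ℕₚ.≮⇒≥ i-not-inside) p≤i , Finₚ.≤-antisym j≤q (ℕₚ.≮⇒≥ j-not-inside)
  where
  i-not-inside : ¬ (p Fin.< i)
  i-not-inside p<i = gap i p<i (ℕₚ.<-≤-trans i<j j≤q) (ℕₚ.≤-trans b≤wj (ℕₚ.<⇒≤ wj<wi) , wi≤a)
  j-not-inside : ¬ (j Fin.< q)
  j-not-inside j<q = gap j (ℕₚ.≤-<-trans p≤i i<j) j<q (b≤wj , ℕₚ.≤-trans (ℕₚ.<⇒≤ wj<wi) wi≤a)

collapsedWeight-endpoints :
  ∀ {n} (w : Permutation′ n) {p q a b : Fin n} → p Fin.≤ q → b Fin.≤ a →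
  w ⟨$⟩ʳ p ≡ a → w ⟨$⟩ʳ q ≡ b → collapsedWeight w p q b a a ≡ collapsedWeight w p q b a b
collapsedWeight-endpoints w {p} {q} p≤q b≤a refl refl =
  trans (Φ-window (ℕₚ.≤-refl {toℕ p}) p≤q b≤a ℕₚ.≤-refl)
        (sym (Φ-window p≤q (ℕₚ.≤-refl {toℕ q}) ℕₚ.≤-refl b≤a))
  where open CollapsedWeight w p q (w ⟨$⟩ʳ q) (w ⟨$⟩ʳ p)

collapsedWeight-supports :
  ∀ {n} (w : Permutation′ n) {p q a b : Fin n} →
  (∀ k → p Fin.< k → k Fin.< q → ¬ (b Fin.≤ w ⟨$⟩ʳ k × w ⟨$⟩ʳ k Fin.≤ a)) →
  w ⟨$⟩ʳ p ≡ a → w ⟨$⟩ʳ q ≡ b →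
  ∀ {c d} → InE w c d →
  collapsedWeight w p q b a c < collapsedWeight w p q b a d ⊎ (c ≡ a × d ≡ b)
collapsedWeight-supports w {p} {q} {a} {b} gap wp≡a wq≡b (i , j , i<j , refl , refl , wj<wi , _)
  with CollapsedWeight.Φ-inversion w p q b a i<j wj<wi
... | inj₁ Φ< = inj₁ Φ<
... | inj₂ (p≤i , j≤q , b≤wj , wi≤a)
  with refl , refl ← inversion-in-window⇒endpoints w gap i<j wj<wi p≤i j≤q b≤wj wi≤a
  = inj₂ (wp≡a , wq≡b)

lemma6p2 : (n : ℕ) (w : Permutation′ n) (a b : Fin n) →
    InE w a b → IsExtremalRay (InD w) (gen a b)
lemma6p2 n w a b ab∈E@(p , q , p<q , wp≡a , wq≡b , b<a , gap) =
  supporting-functional⇒extremal w (collapsedWeight w p q b a)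
    (collapsedWeight-endpoints w (ℕₚ.<⇒≤ p<q) (ℕₚ.<⇒≤ b<a) wp≡a wq≡b)
    (collapsedWeight-supports w gap wp≡a wq≡b)
    ab∈E
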